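{- Let $N\ge 2$ be an integer, $\overline k=k+N\mathbb{Z}\in\mathbb{Z}/N\mathbb{Z}$, and $d$ a divisor of $N$. Then the size of the $\overline k$-monomial minimal solution of $(E_N)$ is a multiple of the size of the $(k+d\mathbb{Z})$-monomial minimal solution of $(E_d)$.
   Context: For an integer $N\ge 1$ and $a_1,\dots,a_n\in\mathbb{Z}/N\mathbb{Z}$, set $M_n(a_1,\dots,a_n)=\begin{pmatrix}a_n&-1\\1&0\end{pmatrix}\cdots\begin{pmatrix}a_1&-1\\1&0\end{pmatrix}$. The equation $(E_N)$ is $M_n(a_1,\dots,a_n)=\pm \mathrm{Id}$ over $\mathbb{Z}/N\mathbb{Z}$; an $n$-tuple satisfying it is a solution of size $n$. The $\overline k$-monomial minimal solution of $(E_N)$ is the $n$-tuple $(\overline k,\dots,\overline k)$ with $n$ the least positive integer for which it is a solution of $(E_N)$; its size is this $n$. -}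

module Defs where

open import Data.Nat using (ℕ; _<_; _≤_)
open import Data.Integer using (ℤ; +_; _+_; _*_; _-_; -_)
open import Data.Integer.Divisibility using () renaming (_∣_ to _∣ℤ_)
open import Data.List using (List; foldl; replicate)
open import Data.Product using (_×_)
open import Data.Sum using (_⊎_)
open import Relation.Nullary using (¬_)

record Mat : Set where
  constructor mat
  field
    a b c d : ℤ

_·_ : Mat → Mat → Mat
mat a b c d · mat a' b' c' d' =
  mat (a * a' + b * c') (a * b' + b * d') (c * a' + d * c') (c * b' + d * d')

Id : Mat
Id = mat (+ 1) (+ 0) (+ 0) (+ 1)

Mx : ℤ → Mat
Mx x = mat x (- (+ 1)) (+ 1) (+ 0)

-- M_n(a_1,...,a_n) = Mx a_n · ... · Mx a_1  (list given as [a_1, ..., a_n])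
Mn : List ℤ → Mat
Mn = foldl (λ acc x → Mx x · acc) Id

_≡_[mod_] : ℤ → ℤ → ℕ → Set
x ≡ y [mod N ] = (+ N) ∣ℤ (x - y)

_≡ₘ_[mod_] : Mat → Mat → ℕ → Set
mat a b c d ≡ₘ mat a' b' c' d' [mod N ] =
  (a ≡ a' [mod N ]) × (b ≡ b' [mod N ]) × (c ≡ c' [mod N ]) × (d ≡ d' [mod N ])

-Id : Mat
-Id = mat (- (+ 1)) (+ 0) (+ 0) (- (+ 1))

IsSolution : ℕ → List ℤ → Set
IsSolution N as = (Mn as ≡ₘ Id [mod N ]) ⊎ (Mn as ≡ₘ -Id [mod N ])

IsMonomialMinimalSize : ℕ → ℤ → ℕ → Set
IsMonomialMinimalSize N k n =
  (1 ≤ n) × IsSolution N (replicate n k)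
    × (∀ m → 1 ≤ m → m < n → ¬ IsSolution N (replicate m k))

-- The k-monomial solutions of (E_d) are the n with M^n ≡ ±Id (mod d), where M = (k -1 ; 1 0).
-- This set is closed under cancellation: M^m ≡ ±Id and M^(m+r) = M^m M^r ≡ ±Id give M^r ≡ ±Id,
-- because a matrix ≡ ±Id is its own inverse up to sign. Hence if m is the least positive element,
-- dividing any element n by m leaves a remainder in the set that is smaller than m, so it is 0.
-- Reduction modulo d maps solutions of (E_N) to solutions of (E_d), so the size of the minimal
-- solution of (E_N) is such an n.
module Submission where

open import Defs
open import Data.Nat as ℕ using (ℕ; zero; suc; z≤n; s≤s; _≤_; _<_; >-nonZero)
open import Data.Nat.Divisibility using (_∣_; ∣-trans; m%n≡0⇒n∣m)
open import Data.Nat.DivMod using (_%_; _/_; m≡m%n+[m/n]*n; m%n<n)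
import Data.Nat.Properties as ℕ
open import Data.Integer using (ℤ; +_; _+_; _*_; _-_; -_)
import Data.Integer.Properties as ℤ
import Data.Integer.Divisibility.Signed as Signed
open import Data.Integer.Tactic.RingSolver using (solve-∀)
open import Data.Sign as Sign using (Sign)
open import Data.Sign.Properties using (s*s≡+)
open import Data.List using (foldl; replicate)
open import Data.Product using (∃-syntax; _,_)
open import Data.Sum as Sum using (inj₁; inj₂)
open import Data.Empty using (⊥-elim)
open import Function using (_∘_)
open import Relation.Nullary using (¬_)
open import Relation.Binary.Bundles using (Setoid)
open import Relation.Binary.PropositionalEquality
  using (_≡_; refl; sym; trans; cong; subst; module ≡-Reasoning)

mat-cong : ∀ {a b c d a′ b′ c′ d′} → a ≡ a′ → b ≡ b′ → c ≡ c′ → d ≡ d′ →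
           mat a b c d ≡ mat a′ b′ c′ d′
mat-cong refl refl refl refl = refl

private
  row-col-assoc : ∀ a b a′ b′ c′ d′ x y →
    (a * a′ + b * c′) * x + (a * b′ + b * d′) * y ≡ a * (a′ * x + b′ * y) + b * (c′ * x + d′ * y)
  row-col-assoc = solve-∀

  1x+0y≡x : ∀ x y → + 1 * x + + 0 * y ≡ x
  1x+0y≡x = solve-∀

  0y+1x≡x : ∀ x y → + 0 * y + + 1 * x ≡ x
  0y+1x≡x = solve-∀

  x1+y0≡x : ∀ x y → x * + 1 + y * + 0 ≡ x
  x1+y0≡x = solve-∀

  y0+x1≡x : ∀ x y → y * + 0 + x * + 1 ≡ x
  y0+x1≡x = solve-∀

·-assoc : ∀ X Y Z → (X · Y) · Z ≡ X · (Y · Z)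
·-assoc (mat a b c d) (mat a′ b′ c′ d′) (mat a″ b″ c″ d″) =
  mat-cong (row-col-assoc a b a′ b′ c′ d′ a″ c″) (row-col-assoc a b a′ b′ c′ d′ b″ d″)
           (row-col-assoc c d a′ b′ c′ d′ a″ c″) (row-col-assoc c d a′ b′ c′ d′ b″ d″)

·-identityˡ : ∀ X → Id · X ≡ X
·-identityˡ (mat a b c d) = mat-cong (1x+0y≡x a c) (1x+0y≡x b d) (0y+1x≡x c a) (0y+1x≡x d b)

·-identityʳ : ∀ X → X · Id ≡ X
·-identityʳ (mat a b c d) = mat-cong (x1+y0≡x a b) (y0+x1≡x b a) (x1+y0≡x c d) (y0+x1≡x d c)

infixr 30 _^_

_^_ : Mat → ℕ → Mat
X ^ zero  = Id
X ^ suc n = X ^ n · X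

^-+ : ∀ X m n → X ^ (m ℕ.+ n) ≡ X ^ m · X ^ n
^-+ X m zero    = trans (cong (X ^_) (ℕ.+-identityʳ m)) (sym (·-identityʳ (X ^ m)))
^-+ X m (suc n) = begin
  X ^ (m ℕ.+ suc n)       ≡⟨ cong (X ^_) (ℕ.+-suc m n) ⟩
  X ^ (m ℕ.+ n) · X       ≡⟨ cong (_· X) (^-+ X m n) ⟩
  (X ^ m · X ^ n) · X     ≡⟨ ·-assoc (X ^ m) (X ^ n) X ⟩
  X ^ m · X ^ suc n       ∎
  where open ≡-Reasoning

foldl-replicate : ∀ k n A → foldl (λ acc x → Mx x · acc) A (replicate n k) ≡ Mx k ^ n · A
foldl-replicate k zero    A = sym (·-identityˡ A)
foldl-replicate k (suc n) A =
  trans (foldl-replicate k n (Mx k · A)) (sym (·-assoc (Mx k ^ n) (Mx k) A))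

Mn-replicate : ∀ k n → Mn (replicate n k) ≡ Mx k ^ n
Mn-replicate k n = trans (foldl-replicate k n Id) (·-identityʳ (Mx k ^ n))

-- x ≡ y [mod n ] is divisibility of absolute values; the proofs pass through signed
-- divisibility, which is closed under sums and products.
module _ {n : ℕ} where

  private
    signed : ∀ x y → x ≡ y [mod n ] → + n Signed.∣ (x - y)
    signed x y = Signed.∣ᵤ⇒∣ {i = x - y}

  ≡-mod-refl : ∀ x → x ≡ x [mod n ]
  ≡-mod-refl x = Signed.∣⇒∣ᵤ (subst (+ n Signed.∣_) (sym (ℤ.+-inverseʳ x)) (Signed.divides (+ 0) refl))

  ≡-mod-sym : ∀ x y → x ≡ y [mod n ] → y ≡ x [mod n ]
  ≡-mod-sym x y p = Signed.∣⇒∣ᵤ (subst (+ n Signed.∣_) (neg-minus x y) (Signed.∣m⇒∣-m (signed x y p)))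
    where
    neg-minus : ∀ x y → - (x - y) ≡ y - x
    neg-minus = solve-∀

  ≡-mod-trans : ∀ x y z → x ≡ y [mod n ] → y ≡ z [mod n ] → x ≡ z [mod n ]
  ≡-mod-trans x y z p q = Signed.∣⇒∣ᵤ (subst (+ n Signed.∣_) (ℤ.+-minus-telescope x y z)
    (Signed.∣m∣n⇒∣m+n (signed x y p) (signed y z q)))

  ≡-mod-dot : ∀ a b c d a′ b′ c′ d′ →
    a ≡ a′ [mod n ] → b ≡ b′ [mod n ] → c ≡ c′ [mod n ] → d ≡ d′ [mod n ] →
    (a * c + b * d) ≡ (a′ * c′ + b′ * d′) [mod n ]
  ≡-mod-dot a b c d a′ b′ c′ d′ p q r s = Signed.∣⇒∣ᵤ (subst (+ n Signed.∣_) (split a b c d a′ b′ c′ d′)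
    (Signed.∣m∣n⇒∣m+n (Signed.∣m∣n⇒∣m+n (Signed.∣m⇒∣m*n c (signed a a′ p)) (Signed.∣n⇒∣m*n a′ (signed c c′ r)))
                      (Signed.∣m∣n⇒∣m+n (Signed.∣m⇒∣m*n d (signed b b′ q)) (Signed.∣n⇒∣m*n b′ (signed d d′ s)))))
    where
    split : ∀ a b c d a′ b′ c′ d′ →
      ((a - a′) * c + a′ * (c - c′)) + ((b - b′) * d + b′ * (d - d′)) ≡ (a * c + b * d) - (a′ * c′ + b′ * d′)
    split = solve-∀

≡ₘ-∣ : ∀ {d N} X Y → d ∣ N → X ≡ₘ Y [mod N ] → X ≡ₘ Y [mod d ]
≡ₘ-∣ (mat _ _ _ _) (mat _ _ _ _) d∣N (p , q , r , s) =
  ∣-trans d∣N p , ∣-trans d∣N q , ∣-trans d∣N r , ∣-trans d∣N s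

IsSolution-∣ : ∀ {d N} → d ∣ N → ∀ as → IsSolution N as → IsSolution d as
IsSolution-∣ d∣N as = Sum.map (≡ₘ-∣ (Mn as) Id d∣N) (≡ₘ-∣ (Mn as) -Id d∣N)

±Id : Sign → Mat
±Id Sign.+ = Id
±Id Sign.- = -Id

±Id-· : ∀ s t → ±Id s · ±Id t ≡ ±Id (s Sign.* t)
±Id-· Sign.+ Sign.+ = refl
±Id-· Sign.+ Sign.- = refl
±Id-· Sign.- Sign.+ = refl
±Id-· Sign.- Sign.- = refl

module MatrixCongruence (n : ℕ) where

  -- A record, unlike the entrywise _≡ₘ_[mod_], lets Agda infer the matrices from the type.
  infix 4 _≈_
  record _≈_ (X Y : Mat) : Set where
    constructor wrap
    field unwrap : X ≡ₘ Y [mod n ]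

  ≈-refl : ∀ {X} → X ≈ X
  ≈-refl {mat a b c d} = wrap (≡-mod-refl a , ≡-mod-refl b , ≡-mod-refl c , ≡-mod-refl d)

  ≈-sym : ∀ {X Y} → X ≈ Y → Y ≈ X
  ≈-sym {mat a b c d} {mat a′ b′ c′ d′} (wrap (p , q , r , s)) =
    wrap (≡-mod-sym a a′ p , ≡-mod-sym b b′ q , ≡-mod-sym c c′ r , ≡-mod-sym d d′ s)

  ≈-trans : ∀ {X Y Z} → X ≈ Y → Y ≈ Z → X ≈ Z
  ≈-trans {mat a b c d} {mat a′ b′ c′ d′} {mat a″ b″ c″ d″} (wrap (p , q , r , s)) (wrap (p′ , q′ , r′ , s′)) =
    wrap (≡-mod-trans a a′ a″ p p′ , ≡-mod-trans b b′ b″ q q′ , ≡-mod-trans c c′ c″ r r′ , ≡-mod-trans d d′ d″ s s′)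

  ≈-setoid : Setoid _ _
  ≈-setoid = record
    { Carrier       = Mat
    ; _≈_           = _≈_
    ; isEquivalence = record { refl = ≈-refl ; sym = ≈-sym ; trans = ≈-trans }
    }

  ·-cong : ∀ {X X′ Y Y′} → X ≈ X′ → Y ≈ Y′ → X · Y ≈ X′ · Y′
  ·-cong {mat a b c d} {mat a′ b′ c′ d′} {mat e f g h} {mat e′ f′ g′ h′}
         (wrap (p , q , r , s)) (wrap (p′ , q′ , r′ , s′)) = wrap
    ( ≡-mod-dot a b e g a′ b′ e′ g′ p q p′ r′ , ≡-mod-dot a b f h a′ b′ f′ h′ p q q′ s′
    , ≡-mod-dot c d e g c′ d′ e′ g′ r s p′ r′ , ≡-mod-dot c d f h c′ d′ f′ h′ r s q′ s′ )

  IsSigned : Mat → Set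
  IsSigned X = ∃[ s ] X ≈ ±Id s

  IsSolution⇒IsSigned : ∀ as → IsSolution n as → IsSigned (Mn as)
  IsSolution⇒IsSigned _ (inj₁ p) = Sign.+ , wrap p
  IsSolution⇒IsSigned _ (inj₂ p) = Sign.- , wrap p

  IsSigned⇒IsSolution : ∀ as → IsSigned (Mn as) → IsSolution n as
  IsSigned⇒IsSolution _ (Sign.+ , wrap p) = inj₁ p
  IsSigned⇒IsSolution _ (Sign.- , wrap p) = inj₂ p

  IsSigned-cancelˡ : ∀ {X Y} → IsSigned X → IsSigned (X · Y) → IsSigned Y
  IsSigned-cancelˡ {X} {Y} (s , X≈s) (t , XY≈t) = s Sign.* t , (begin
    Y                       ≡⟨ ·-identityˡ Y ⟨
    ±Id Sign.+ · Y          ≡⟨ cong (λ u → ±Id u · Y) (s*s≡+ s) ⟨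
    ±Id (s Sign.* s) · Y    ≡⟨ cong (_· Y) (±Id-· s s) ⟨
    (±Id s · ±Id s) · Y     ≡⟨ ·-assoc (±Id s) (±Id s) Y ⟩
    ±Id s · (±Id s · Y)     ≈⟨ ·-cong (≈-refl {±Id s}) (·-cong (≈-sym X≈s) (≈-refl {Y})) ⟩
    ±Id s · (X · Y)         ≈⟨ ·-cong (≈-refl {±Id s}) XY≈t ⟩
    ±Id s · ±Id t           ≡⟨ ±Id-· s t ⟩
    ±Id (s Sign.* t)        ∎)
    where open import Relation.Binary.Reasoning.Setoid ≈-setoid

  monomial-cancelˡ : ∀ k m r → IsSolution n (replicate m k) → IsSolution n (replicate (m ℕ.+ r) k) →
                     IsSolution n (replicate r k)
  monomial-cancelˡ k m r sol-m sol-m+r =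
    IsSigned⇒IsSolution (replicate r k) (subst IsSigned (sym (Mn-replicate k r))
      (IsSigned-cancelˡ (power-IsSigned m sol-m)
                        (subst IsSigned (^-+ (Mx k) m r) (power-IsSigned (m ℕ.+ r) sol-m+r))))
    where
    power-IsSigned : ∀ j → IsSolution n (replicate j k) → IsSigned (Mx k ^ j)
    power-IsSigned j = subst IsSigned (Mn-replicate k j) ∘ IsSolution⇒IsSigned (replicate j k)

minimal-∣ : (P : ℕ → Set) → (∀ m r → P m → P (m ℕ.+ r) → P r) →
            ∀ {m} → 1 ≤ m → P m → (∀ j → 1 ≤ j → j < m → ¬ P j) → ∀ n → P n → m ∣ n
minimal-∣ P cancel {m} 1≤m Pm below n Pn = m%n≡0⇒n∣m n m (below⇒≡0 (n % m) (m%n<n n m) P[n%m])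
  where
  instance
    m≢0 : ℕ.NonZero m
    m≢0 = >-nonZero 1≤m

  cancel-multiple : ∀ q {r} → P (q ℕ.* m ℕ.+ r) → P r
  cancel-multiple zero    Pr = Pr
  cancel-multiple (suc q) {r} P[m+qm+r] =
    cancel-multiple q (cancel m (q ℕ.* m ℕ.+ r) Pm (subst P (ℕ.+-assoc m (q ℕ.* m) r) P[m+qm+r]))

  P[n%m] : P (n % m)
  P[n%m] = cancel-multiple (n / m)
    (subst P (trans (m≡m%n+[m/n]*n n m) (ℕ.+-comm (n % m) (n / m ℕ.* m))) Pn)

  below⇒≡0 : ∀ r → r < m → P r → r ≡ 0
  below⇒≡0 zero    _   _  = refl
  below⇒≡0 (suc r) r<m Pr = ⊥-elim (below (suc r) (s≤s z≤n) r<m Pr)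

mainTheorem4 : (N : ℕ) → 2 ≤ N → (k : ℤ) → (d : ℕ) → d ∣ N →
    (n m : ℕ) → IsMonomialMinimalSize N k n → IsMonomialMinimalSize d k m →
    m ∣ n
mainTheorem4 N _ k d d∣N n m (_ , sol-n , _) (1≤m , sol-m , below) =
  minimal-∣ (λ j → IsSolution d (replicate j k)) (MatrixCongruence.monomial-cancelˡ d k)
            1≤m sol-m below n (IsSolution-∣ d∣N (replicate n k) sol-n)
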